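{- Let $k,h,d$ be positive integers, $a$ a positive integer with $\gcd(a,d)=1$, and $B=(b_1,\dots,b_k)$ positive integers such that $A=(a,\ ha+db_1,\ \dots,\ ha+db_k)$ satisfies $\gcd(A)=1$. For $0\leq r\leq a-1$, $$N_{dr}=\min \{O_B(ma+r)\cdot ha+(ma+r)d \mid m\in \mathbb{N}\},$$ where $N_{dr}=\min\{a_0\in\mathbb{N} : a_0\equiv dr \pmod a,\ a_0=\sum_{i=1}^k(ha+db_i)x_i \text{ for some } x_i\in\mathbb{N}\}$.
   Context: $\mathbb{N}=\{0,1,2,\dots\}$. For an integer $M$, $O_B(M)=\min\{\sum_{i=1}^kx_i : \sum_{i=1}^k b_ix_i=M,\ x_i\in\mathbb{N}\}$, with the convention that the minimum over an empty set is $+\infty$. -}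

module Defs where

open import Data.Nat using (ℕ; _+_; _*_; _≤_; _%_; NonZero)
open import Data.Nat.GCD using (gcd)
open import Data.Fin using (Fin)
open import Data.List using (List; _∷_; map)
import Data.List as L
open import Data.Vec.Functional using (Vector; toList; foldr)
open import Data.Product using (Σ; _×_)
open import Relation.Binary.PropositionalEquality using (_≡_)

Σᶠ : ∀ {k} → Vector ℕ k → ℕ
Σᶠ v = foldr _+_ 0 v

gcdList : List ℕ → ℕ
gcdList = L.foldr gcd 0

tupleA : ∀ {k} → ℕ → ℕ → ℕ → Vector ℕ k → List ℕ
tupleA a h d B = a ∷ map (λ b → h * a + d * b) (toList B)

IsMin : (ℕ → Set) → ℕ → Set
IsMin P n = P n × (∀ m → P m → n ≤ m)

RepB : ∀ {k} → Vector ℕ k → ℕ → ℕ → Set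
RepB {k} B M s = Σ (Vector ℕ k) (λ x → (Σᶠ (λ i → B i * x i) ≡ M) × (Σᶠ x ≡ s))

-- O_B(M) = s  (O_B(M) finite and equal to s); O_B(M) = +∞ iff no s satisfies this
OB≡ : ∀ {k} → Vector ℕ k → ℕ → ℕ → Set
OB≡ B M s = IsMin (RepB B M) s

NSet : ∀ {k} → (a h d r : ℕ) → .{{NonZero a}} → Vector ℕ k → ℕ → Set
NSet {k} a h d r B a0 =
  (a0 % a ≡ (d * r) % a) ×
  Σ (Vector ℕ k) (λ x → a0 ≡ Σᶠ (λ i → (h * a + d * B i) * x i))

-- the set { O_B(ma+r)·ha + (ma+r)d | m ∈ ℕ }  (terms with O_B = +∞ omitted; they never attain a finite minimum)
OSet : ∀ {k} → (a h d r : ℕ) → Vector ℕ k → ℕ → Set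
OSet {k} a h d r B v =
  Σ ℕ (λ m → Σ ℕ (λ s → OB≡ B (m * a + r) s × (v ≡ s * (h * a) + (m * a + r) * d)))

{-# OPTIONS --safe #-}
module Submission where

-- Write A′ for the generators h a + d b_i. For x ∈ ℕ^k, A′ · x = (Σ x) h a + (B · x) d ≡ (B · x) d (mod a),
-- so, as gcd(a, d) = 1, the condition A′ · x ≡ d r forces B · x ≡ r, i.e. B · x = m a + r. Among the x with
-- a fixed value of B · x, A′ · x increases with Σ x; hence the least element of the set defining N_{dr} comes
-- from an O_B-optimal representation of some m a + r, while every value O_B(m a + r) h a + (m a + r) d lies in
-- that set. The set is nonempty because gcd(a, gcd A′) = 1 lets A′ · x reach every residue class mod a, and it is
-- decidable because the generators are positive.

open import Defs
open import Data.Nat using (ℕ; zero; suc; _+_; _*_; _∸_; _<_; _≤_; _%_; _/_; pred; NonZero; >-nonZero; >-nonZero⁻¹; s≤s; _≟_; _≤?_)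
open import Data.Nat.Properties
open import Data.Nat.DivMod hiding (_mod_)
open import Data.Nat.Divisibility using (n∣m*n; m∣m*n; ∣n⇒∣m*n)
open import Data.Nat.GCD using (gcd; gcd-GCD; module Bézout)
open import Data.Nat.Induction using (<-wellFounded)
open import Induction.WellFounded using (Acc; acc)
open import Data.Fin using (Fin)
open import Data.List.Properties using (map-tabulate)
open import Data.Vec.Functional using (Vector; toList; _∷_; head; tail)
open import Data.Product using (Σ; ∃; ∃₂; _×_; _,_; proj₂)
open import Relation.Nullary using (yes; no; _×-dec_)
open import Relation.Nullary.Decidable using (map′)
open import Relation.Unary using (Decidable; _⊆_)
open import Relation.Binary.PropositionalEquality
open import Data.Nat.Tactic.RingSolver using (solve-∀)
open ≡-Reasoning

least : {P : ℕ → Set} → Decidable P → ∀ {n} → P n → ∃ (IsMin P)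
least {P} P? Pn = go (<-wellFounded _) Pn
  where
  go : ∀ {n} → Acc _<_ n → P n → ∃ (IsMin P)
  go {n} (acc rs) Pn with anyUpTo? P? n
  ... | yes (j , j<n , Pj) = go (rs j<n) Pj
  ... | no ∄ = n , Pn , λ m Pm → ≮⇒≥ λ m<n → ∄ (m , m<n , Pm)

IsMin-⊆ : {P Q : ℕ → Set} {n : ℕ} → P ⊆ Q → IsMin Q n → P n → IsMin P n
IsMin-⊆ P⊆Q (_ , minQ) Pn = Pn , λ m Pm → minQ m (P⊆Q Pm)

infixl 7 _∙_
_∙_ : ∀ {k} → Vector ℕ k → Vector ℕ k → ℕ
c ∙ x = Σᶠ (λ i → c i * x i)

∙-scaleʳ : ∀ {k} (c y : Vector ℕ k) t → c ∙ (λ i → t * y i) ≡ t * (c ∙ y)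
∙-scaleʳ {zero} c y t = sym (*-zeroʳ t)
∙-scaleʳ {suc k} c y t = begin
  head c * (t * head y) + tail c ∙ (λ i → t * tail y i) ≡⟨ cong (head c * (t * head y) +_) (∙-scaleʳ (tail c) (tail y) t) ⟩
  head c * (t * head y) + t * (tail c ∙ tail y)         ≡⟨ ring (head c) (head y) t (tail c ∙ tail y) ⟩
  t * (head c * head y + tail c ∙ tail y)               ∎
  where
  ring : ∀ c y t s → c * (t * y) + t * s ≡ t * (c * y + s)
  ring = solve-∀

∙-affine : ∀ {k} (b x : Vector ℕ k) p q → (λ i → p + q * b i) ∙ x ≡ Σᶠ x * p + (b ∙ x) * q
∙-affine {zero} b x p q = refl
∙-affine {suc k} b x p q = begin
  (p + q * head b) * head x + (λ i → p + q * tail b i) ∙ tail x ≡⟨ cong ((p + q * head b) * head x +_) (∙-affine (tail b) (tail x) p q) ⟩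
  (p + q * head b) * head x + (Σᶠ (tail x) * p + (tail b ∙ tail x) * q)
    ≡⟨ ring p q (head b) (head x) (Σᶠ (tail x)) (tail b ∙ tail x) ⟩
  (head x + Σᶠ (tail x)) * p + (head b * head x + tail b ∙ tail x) * q ∎
  where
  ring : ∀ p q b x s t → (p + q * b) * x + (s * p + t * q) ≡ (x + s) * p + (b * x + t) * q
  ring = solve-∀

Representable : ∀ {k} → Vector ℕ k → ℕ → Set
Representable {k} c n = Σ (Vector ℕ k) λ x → n ≡ c ∙ x

-- A positive first coefficient bounds the first coordinate of a representation of n by n.
representable? : ∀ {k} (c : Vector ℕ k) → (∀ i → NonZero (c i)) → Decidable (Representable c)
representable? {zero} c _ n = map′ (λ n≡0 → (λ ()) , n≡0) proj₂ (n ≟ 0)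
representable? {suc k} c c≢0 n = map′ from to (anyUpTo? P? (suc n))
  where
  P : ℕ → Set
  P j = head c * j ≤ n × Representable (tail c) (n ∸ head c * j)
  P? : Decidable P
  P? j = (head c * j ≤? n) ×-dec representable? (tail c) (λ i → c≢0 (Fin.suc i)) (n ∸ head c * j)
  from : ∃ (λ j → j < suc n × P j) → Representable c n
  from (j , _ , cj≤n , x , eq) = (j ∷ x) , trans (sym (m+[n∸m]≡n cj≤n)) (cong (head c * j +_) eq)
  to : Representable c n → ∃ (λ j → j < suc n × P j)
  to (x , eq) = head x , s≤s (≤-trans (m≤n*m (head x) (head c) {{c≢0 Fin.zero}}) cx≤n) , cx≤n , tail x , rest
    where
    cx≤n : head c * head x ≤ n
    cx≤n = subst (head c * head x ≤_) (sym eq) (m≤m+n _ _)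
    rest : n ∸ head c * head x ≡ tail c ∙ tail x
    rest = trans (cong (_∸ head c * head x) eq) (m+n∸m≡n (head c * head x) (tail c ∙ tail x))

infix 4 _≡_mod_
_≡_mod_ : ℕ → ℕ → (a : ℕ) → .{{NonZero a}} → Set
m ≡ n mod a = m % a ≡ n % a

module _ {a : ℕ} .{{_ : NonZero a}} where

  +-congˡ-mod : ∀ t {m n} → m ≡ n mod a → t + m ≡ t + n mod a
  +-congˡ-mod t {m} {n} m≡n = begin
    (t + m) % a           ≡⟨ %-distribˡ-+ t m a ⟩
    (t % a + m % a) % a   ≡⟨ cong (λ u → (t % a + u) % a) m≡n ⟩
    (t % a + n % a) % a   ≡⟨ %-distribˡ-+ t n a ⟨
    (t + n) % a           ∎

  *-congˡ-mod : ∀ t {m n} → m ≡ n mod a → t * m ≡ t * n mod a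
  *-congˡ-mod t {m} {n} m≡n = begin
    (t * m) % a           ≡⟨ %-distribˡ-* t m a ⟩
    (t % a * (m % a)) % a ≡⟨ cong (λ u → (t % a * u) % a) m≡n ⟩
    (t % a * (n % a)) % a ≡⟨ %-distribˡ-* t n a ⟨
    (t * n) % a           ∎

  -- n * pred a represents − n modulo a.
  +-moveʳ-mod : ∀ {g n p} → g + n ≡ p → g ≡ p + n * pred a mod a
  +-moveʳ-mod {g} {n} {p} g+n≡p = begin
    g % a                      ≡⟨ [m+kn]%n≡m%n g n a ⟨
    (g + n * a) % a            ≡⟨ cong (λ u → (g + n * u) % a) (suc-pred a) ⟨
    (g + n * suc (pred a)) % a ≡⟨ cong (λ u → (g + u) % a) (*-suc n (pred a)) ⟩
    (g + (n + n * pred a)) % a ≡⟨ cong (_% a) (+-assoc g n (n * pred a)) ⟨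
    (g + n + n * pred a) % a   ≡⟨ cong (λ u → (u + n * pred a) % a) g+n≡p ⟩
    (p + n * pred a) % a       ∎

  bézout-mod : ∀ m n → ∃₂ λ u v → m * u + n * v ≡ gcd m n mod a
  bézout-mod m n with Bézout.identity (gcd-GCD m n)
  ... | Bézout.+- x y eq = x , y * pred a , trans (cong (_% a) (ring m n x y (pred a))) (sym (+-moveʳ-mod eq))
    where
    ring : ∀ m n x y p → m * x + n * (y * p) ≡ x * m + y * n * p
    ring = solve-∀
  ... | Bézout.-+ x y eq = x * pred a , y , trans (cong (_% a) (ring m n x y (pred a))) (sym (+-moveʳ-mod eq))
    where
    ring : ∀ m n x y p → m * (x * p) + n * y ≡ y * n + x * m * p
    ring = solve-∀

  ∙-gcdList-mod : ∀ {k} (c : Vector ℕ k) → ∃ λ y → c ∙ y ≡ gcdList (toList c) mod a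
  ∙-gcdList-mod {zero} c = (λ ()) , refl
  ∙-gcdList-mod {suc k} c with ∙-gcdList-mod (tail c) | bézout-mod (head c) (gcdList (toList (tail c)))
  ... | y , cy≡g | u , v , bézout = (u ∷ λ i → v * y i) , (begin
    (head c * u + tail c ∙ (λ i → v * y i)) % a ≡⟨ cong (λ t → (head c * u + t) % a) (∙-scaleʳ (tail c) y v) ⟩
    (head c * u + v * (tail c ∙ y)) % a         ≡⟨ +-congˡ-mod (head c * u) (*-congˡ-mod v cy≡g) ⟩
    (head c * u + v * g) % a                    ≡⟨ cong (λ t → (head c * u + t) % a) (*-comm v g) ⟩
    (head c * u + g * v) % a                    ≡⟨ bézout ⟩
    gcd (head c) g % a                          ∎)
    where
    g : ℕ
    g = gcdList (toList (tail c))

  coprime⇒invertible-mod : ∀ {g} → gcd a g ≡ 1 → ∃ λ v → g * v ≡ 1 mod a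
  coprime⇒invertible-mod {g} a⊥g with bézout-mod a g
  ... | u , v , bézout = v , (begin
    (g * v) % a         ≡⟨ %-remove-+ˡ (g * v) (m∣m*n u) ⟨
    (a * u + g * v) % a ≡⟨ bézout ⟩
    gcd a g % a         ≡⟨ cong (_% a) a⊥g ⟩
    1 % a               ∎)

  *-cancelʳ-mod : ∀ {d m n} → gcd a d ≡ 1 → m * d ≡ n * d mod a → m ≡ n mod a
  *-cancelʳ-mod {d} {m} {n} a⊥d md≡nd with coprime⇒invertible-mod a⊥d
  ... | v , dv≡1 = begin
    m % a              ≡⟨ cong (_% a) (*-identityʳ m) ⟨
    (m * 1) % a        ≡⟨ *-congˡ-mod m dv≡1 ⟨
    (m * (d * v)) % a  ≡⟨ cong (_% a) (*-assoc m d v) ⟨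
    (m * d * v) % a    ≡⟨ cong (_% a) (*-comm (m * d) v) ⟩
    (v * (m * d)) % a  ≡⟨ *-congˡ-mod v md≡nd ⟩
    (v * (n * d)) % a  ≡⟨ cong (_% a) (trans (*-comm v (n * d)) (*-assoc n d v)) ⟩
    (n * (d * v)) % a  ≡⟨ *-congˡ-mod n dv≡1 ⟩
    (n * 1) % a        ≡⟨ cong (_% a) (*-identityʳ n) ⟩
    n % a              ∎

  ∙-surjective-mod : ∀ {k} (c : Vector ℕ k) → gcd a (gcdList (toList c)) ≡ 1 →
                     ∀ t → ∃ λ x → c ∙ x ≡ t mod a
  ∙-surjective-mod c a⊥c t with ∙-gcdList-mod c | coprime⇒invertible-mod a⊥c
  ... | y , cy≡g | v , gv≡1 = (λ i → t * v * y i) , (begin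
    (c ∙ (λ i → t * v * y i)) % a ≡⟨ cong (_% a) (∙-scaleʳ c y (t * v)) ⟩
    (t * v * (c ∙ y)) % a         ≡⟨ *-congˡ-mod (t * v) cy≡g ⟩
    (t * v * g) % a               ≡⟨ cong (_% a) (trans (*-assoc t v g) (cong (t *_) (*-comm v g))) ⟩
    (t * (g * v)) % a             ≡⟨ *-congˡ-mod t gv≡1 ⟩
    (t * 1) % a                   ≡⟨ cong (_% a) (*-identityʳ t) ⟩
    t % a                         ∎)
    where
    g : ℕ
    g = gcdList (toList c)

A′ : ∀ {k} → ℕ → ℕ → ℕ → Vector ℕ k → Vector ℕ k
A′ a h d B i = h * a + d * B i

module _ {k} (a h d : ℕ) .{{_ : NonZero a}} (B : Vector ℕ k) where

  A′-∙ : ∀ x → A′ a h d B ∙ x ≡ Σᶠ x * (h * a) + (B ∙ x) * d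
  A′-∙ x = ∙-affine B x (h * a) d

  A′-∙-mod : ∀ x → A′ a h d B ∙ x ≡ (B ∙ x) * d mod a
  A′-∙-mod x = trans (cong (_% a) (A′-∙ x)) (%-remove-+ˡ ((B ∙ x) * d) (∣n⇒∣m*n (Σᶠ x) (n∣m*n h)))

  NSet? : ∀ r → (∀ i → NonZero (A′ a h d B i)) → Decidable (NSet a h d r B)
  NSet? r A′≢0 a₀ = (a₀ % a ≟ (d * r) % a) ×-dec representable? (A′ a h d B) A′≢0 a₀

  NSet-hasLeast : (∀ i → NonZero (A′ a h d B i)) → gcd a (gcdList (toList (A′ a h d B))) ≡ 1 →
               ∀ r → ∃ (IsMin (NSet a h d r B))
  NSet-hasLeast A′≢0 a⊥A′ r with ∙-surjective-mod (A′ a h d B) a⊥A′ (d * r)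
  ... | x , A′x≡dr = least (NSet? r A′≢0) (A′x≡dr , x , refl)

  OSet⊆NSet : ∀ r → OSet a h d r B ⊆ NSet a h d r B
  OSet⊆NSet r {v} (m , s , ((x , Bx≡ma+r , Σx≡s) , _) , v≡) = v≡dr , x , v≡A′x
    where
    v≡A′x : v ≡ A′ a h d B ∙ x
    v≡A′x = trans v≡ (sym (trans (A′-∙ x) (cong₂ (λ p q → p * (h * a) + q * d) Σx≡s Bx≡ma+r)))
    ring : ∀ m a r d → (m * a + r) * d ≡ d * r + m * d * a
    ring = solve-∀
    v≡dr : v % a ≡ (d * r) % a
    v≡dr = begin
      v % a                       ≡⟨ cong (_% a) v≡A′x ⟩
      (A′ a h d B ∙ x) % a        ≡⟨ A′-∙-mod x ⟩
      ((B ∙ x) * d) % a           ≡⟨ cong (λ M → (M * d) % a) Bx≡ma+r ⟩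
      ((m * a + r) * d) % a       ≡⟨ cong (_% a) (ring m a r d) ⟩
      (d * r + m * d * a) % a     ≡⟨ [m+kn]%n≡m%n (d * r) (m * d) a ⟩
      (d * r) % a                 ∎

  -- Representations of one M by B differ in their A′-value only through h a Σᶠ x.
  least-NSet⇒OB : ∀ {r N} .{{_ : NonZero h}} → IsMin (NSet a h d r B) N →
                  ∀ x → N ≡ A′ a h d B ∙ x → OB≡ B (B ∙ x) (Σᶠ x)
  least-NSet⇒OB {r} {N} ((N≡dr , _) , minimal) x N≡A′x = (x , refl , refl) , Σx-least
    where
    Σx-least : ∀ s → RepB B (B ∙ x) s → Σᶠ x ≤ s
    Σx-least s (y , By≡Bx , Σy≡s) = *-cancelʳ-≤ (Σᶠ x) s (h * a) {{m*n≢0 h a}} (+-cancelʳ-≤ ((B ∙ x) * d) _ _ N≤A′y)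
      where
      A′y≡ : A′ a h d B ∙ y ≡ s * (h * a) + (B ∙ x) * d
      A′y≡ = trans (A′-∙ y) (cong₂ (λ p q → p * (h * a) + q * d) Σy≡s By≡Bx)
      A′y≡dr : (A′ a h d B ∙ y) % a ≡ (d * r) % a
      A′y≡dr = begin
        (A′ a h d B ∙ y) % a  ≡⟨ A′-∙-mod y ⟩
        ((B ∙ y) * d) % a     ≡⟨ cong (λ M → (M * d) % a) By≡Bx ⟩
        ((B ∙ x) * d) % a     ≡⟨ A′-∙-mod x ⟨
        (A′ a h d B ∙ x) % a  ≡⟨ cong (_% a) N≡A′x ⟨
        N % a                 ≡⟨ N≡dr ⟩
        (d * r) % a           ∎
      N≤A′y : Σᶠ x * (h * a) + (B ∙ x) * d ≤ s * (h * a) + (B ∙ x) * d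
      N≤A′y = subst₂ _≤_ (trans N≡A′x (A′-∙ x)) A′y≡ (minimal (A′ a h d B ∙ y) (A′y≡dr , y , refl))

  least-NSet⇒OSet : ∀ {r N} .{{_ : NonZero h}} → gcd a d ≡ 1 → r < a →
                    IsMin (NSet a h d r B) N → OSet a h d r B N
  least-NSet⇒OSet {r} {N} a⊥d r<a N-least@((N≡dr , x , N≡A′x) , _) =
    M / a , Σᶠ x , subst (λ M′ → OB≡ B M′ (Σᶠ x)) M≡[M/a]a+r (least-NSet⇒OB N-least x N≡A′x) ,
    trans N≡A′x (trans (A′-∙ x) (cong (λ M′ → Σᶠ x * (h * a) + M′ * d) M≡[M/a]a+r))
    where
    M : ℕ
    M = B ∙ x
    M≡r : M ≡ r mod a
    M≡r = *-cancelʳ-mod a⊥d (begin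
      (M * d) % a             ≡⟨ A′-∙-mod x ⟨
      (A′ a h d B ∙ x) % a    ≡⟨ cong (_% a) N≡A′x ⟨
      N % a                   ≡⟨ N≡dr ⟩
      (d * r) % a             ≡⟨ cong (_% a) (*-comm d r) ⟩
      (r * d) % a             ∎)
    M≡[M/a]a+r : M ≡ M / a * a + r
    M≡[M/a]a+r = begin
      M                 ≡⟨ m≡m%n+[m/n]*n M a ⟩
      M % a + M / a * a ≡⟨ cong (_+ M / a * a) (trans M≡r (m<n⇒m%n≡m r<a)) ⟩
      r + M / a * a     ≡⟨ +-comm r (M / a * a) ⟩
      M / a * a + r     ∎

lemma2p3 : (k h d a : ℕ) → .{{_ : NonZero a}} → (B : Vector ℕ k) →
    0 < k → 0 < h → 0 < d → 0 < a → gcd a d ≡ 1 →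
    (∀ i → 0 < B i) → gcdList (tupleA a h d B) ≡ 1 →
    (r : ℕ) → r < a →
    Σ ℕ (λ N → IsMin (NSet a h d r B) N × IsMin (OSet a h d r B) N)
lemma2p3 k h d a B _ 0<h _ _ a⊥d _ gcdA≡1 r r<a =
  let N , N-least = NSet-hasLeast a h d B A′≢0 a⊥A′ r in
  N , N-least , IsMin-⊆ (OSet⊆NSet a h d B r) N-least (least-NSet⇒OSet a h d B a⊥d r<a N-least)
  where
  instance
    h≢0 : NonZero h
    h≢0 = >-nonZero 0<h
  A′≢0 : ∀ i → NonZero (A′ a h d B i)
  A′≢0 i = >-nonZero (<-≤-trans (>-nonZero⁻¹ (h * a) {{m*n≢0 h a}}) (m≤m+n (h * a) (d * B i)))
  a⊥A′ : gcd a (gcdList (toList (A′ a h d B))) ≡ 1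
  a⊥A′ = subst (λ L → gcd a (gcdList L) ≡ 1) (map-tabulate B (λ b → h * a + d * b)) gcdA≡1
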